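{- Let $\Delta,M,t,m$ be positive integers. Let $X=\{x_1,\dots,x_t\}$ be a set of vertices in a graph $G$. Suppose that we have rooted trees $T_{x_1},\dots,T_{x_t}$ satisfying $\sum_{i=1}^t|T_{x_i}|\leq M$ and $\Delta(T_{x_i})\leq\Delta$ for all $i$. Suppose that for all $S\subseteq V(G)$ with $m\leq|S|\leq 2m$ we have $|\Gamma(S)|\geq M+10\Delta m$, and for all $S\subseteq V(G)$ with $|S|\leq m$ we have $$|\Gamma(S)\setminus X|\geq 4\Delta|S\setminus X|+\sum_{x\in S\cap X}\big(d_{root}(T_x)+\Delta\big).$$ Then we can find disjoint copies of the trees $T_{x_1},\dots,T_{x_t}$ in $G$ such that for each $i$ the copy of $T_{x_i}$ is rooted at $x_i$. In addition, for all $S\subseteq V(G)$ with $|S|\leq m$ we have $$|\Gamma(S)\setminus(T_{x_1}\cup\dots\cup T_{x_t})|\geq\Delta|S|,$$ where $T_{x_1}\cup\dots\cup T_{x_t}$ denotes the union of the vertex sets of the copies.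
   Context: For a vertex $x$ in a graph $G$, $\Gamma(x)=N(x)$ is the set of neighbours of $x$, and for a set $S$ of vertices, $\Gamma(S)=\bigcup_{x\in S}\Gamma(x)$ (note that vertices of $S$ are not removed). For a tree $T$ rooted at $v$, $d_{root}(T)=d_T(v)$ is the degree of the root. $\Delta(T)$ is the maximum degree of $T$. -}

module Defs where

open import Data.Nat using (ℕ; zero; suc; _+_; _≤_)
open import Data.Bool using (Bool; true; false; _∧_; _∨_; if_then_else_)
open import Data.Fin using (Fin; zero; suc; toℕ; _≟_)
open import Data.Fin.Subset using (Subset; _∈_; _∉_; ∣_∣)
open import Data.Vec using (Vec; tabulate; lookup; sum)
open import Data.Product using (Σ; _×_; _,_)
open import Relation.Binary.PropositionalEquality using (_≡_; _≢_)
open import Relation.Nullary.Decidable using (⌊_⌋)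
open import Function.Definitions using (Injective)

anyFin : {k : ℕ} → (Fin k → Bool) → Bool
anyFin {zero}  f = false
anyFin {suc k} f = f zero ∨ anyFin (λ i → f (suc i))

sumFin : {k : ℕ} → (Fin k → ℕ) → ℕ
sumFin f = sum (tabulate f)

record Graph (n : ℕ) : Set where
  field
    adj   : Fin n → Fin n → Bool
    sym   : ∀ u v → adj u v ≡ adj v u
    irrefl : ∀ v → adj v v ≡ false
open Graph public

-- Γ(S) = union of neighbourhoods of vertices of S (S not removed).
Γ : {n : ℕ} → Graph n → Subset n → Subset n
Γ G S = tabulate λ v → anyFin λ u → lookup S u ∧ adj G u v

-- A rooted tree with vertex set Fin (suc k), root zero; vertex (suc j)
-- has parent (parent j) whose index is at most j (so every vertex
-- precedes its children; every finite rooted tree is isomorphic to one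
-- of this form).  Edges are {suc j , parent j}.
record RootedTree : Set where
  field
    k        : ℕ
    parent   : Fin k → Fin (suc k)
    parent<  : ∀ j → toℕ (parent j) ≤ toℕ j
open RootedTree public

size : RootedTree → ℕ
size T = suc (k T)

V : RootedTree → Set
V T = Fin (size T)

children : (T : RootedTree) → V T → ℕ
children T v = sumFin λ j → if ⌊ parent T j ≟ v ⌋ then 1 else 0

deg : (T : RootedTree) → V T → ℕ
deg T zero    = children T zero
deg T (suc j) = suc (children T (suc j))

droot : RootedTree → ℕ
droot T = deg T zero

MaxDegLe : RootedTree → ℕ → Set
MaxDegLe T D = ∀ v → deg T v ≤ D

IsRootedCopy : {n : ℕ} → Graph n → (T : RootedTree) → Fin n → (V T → Fin n) → Set
IsRootedCopy G T x φ =
  Injective _≡_ _≡_ φ × (φ zero ≡ x) × (∀ j → adj G (φ (suc j)) (φ (parent T j)) ≡ true)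

UnionImage : {n t : ℕ} → (T : Fin t → RootedTree) → ((i : Fin t) → V (T i) → Fin n) → Subset n
UnionImage T φ = tabulate λ v → anyFin λ i → anyFin λ a → ⌊ φ i a ≟ v ⌋

XSet : {n t : ℕ} → (Fin t → Fin n) → Subset n
XSet x = tabulate λ v → anyFin λ i → ⌊ x i ≟ v ⌋

-- Σ_{x ∈ S ∩ X} (d_root(T_x) + Δ)   (x is injective, so summing over i is the same)
rootWeight : {n t : ℕ} → (Fin t → Fin n) → (Fin t → RootedTree) → ℕ → Subset n → ℕ
rootWeight x T D S = sumFin λ i → if lookup S (x i) then droot (T i) + D else 0

-- The trees are embedded greedily, one vertex at a time, maintaining the
-- set F of used vertices and weights Δ ≤ w ≤ 2Δ such that every S with
-- |S| ≤ m has at least Σ_{v ∈ S} w v neighbours outside F.  Initially the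
-- roots x_i weigh d_root(T_{x_i}) + Δ and all other vertices 2Δ, so this is
-- the second hypothesis; at the end w ≥ Δ gives the extra expansion.
--
-- To embed a child of the vertex y, consider the largest set U avoiding y
-- on which the inequality is tight.  Tight sets are closed under union since
-- S ↦ |Γ(S) ∖ F| is submodular and weights are modular, the first
-- hypothesis ruling out unions of more than m vertices.  Then U ∪ {y} has a
-- free neighbour z outside Γ(U); it is adjacent to y, and using z costs one
-- unit of y's weight while z receives Δ plus its number of children.
module Submission where

open import Defs hiding (sym)
open import Data.Bool using (Bool; true; false; _∧_; _∨_; not; if_then_else_)
import Data.Bool.Properties as Bool
open import Data.Empty using (⊥-elim)
open import Data.Fin using (Fin; zero; suc; toℕ; fromℕ<; _≟_)
import Data.Fin.Properties as Fin
open import Data.Fin.Subset using (Subset; _─_; ∣_∣)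
open import Data.List using (List; []; _∷_; _++_; map; filter)
open import Data.List.Membership.Propositional using (_∈_)
open import Data.List.Membership.Propositional.Properties using (∈-++⁺ˡ; ∈-++⁺ʳ; ∈-map⁺; ∈-filter⁺)
open import Data.List.Relation.Unary.All using (All; []; _∷_)
open import Data.List.Relation.Unary.Any using (here; there)
open import Data.List.Relation.Unary.All.Properties using (all-filter)
open import Data.Nat using (ℕ; zero; suc; _+_; _*_; _≤_; _<_; _∸_; z≤n; s≤s; z<s; s≤s⁻¹; _≤?_; _<?_; >-nonZero)
open import Data.Nat.Properties hiding (_≟_)
open import Algebra.Properties.Semiring.Sum +-*-semiring
  using (sum; sum-cong-≗; ∑-distrib-+; ∑-comm; *-distribˡ-sum)
open import Data.Product using (Σ; ∃; _×_; _,_; proj₁; proj₂)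
open import Data.Vec using ([]; _∷_; tabulate; lookup)
open import Data.Vec.Properties using (lookup∘tabulate)
open import Data.Vec.Functional using (updateAt)
open import Data.Vec.Functional.Properties using (updateAt-updates; updateAt-minimal)
open import Function using (_∘_; id)
open import Function.Definitions using (Injective)
open import Relation.Binary.PropositionalEquality
open import Relation.Nullary using (¬_; Dec; yes; no; contradiction)
open import Relation.Nullary.Decidable using (⌊_⌋; _×-dec_)

sumFin≡sum : ∀ {n} (f : Fin n → ℕ) → sumFin f ≡ sum f
sumFin≡sum {zero}  f = refl
sumFin≡sum {suc n} f = cong (f zero +_) (sumFin≡sum (f ∘ suc))

sum-mono-≤ : ∀ {n} {f g : Fin n → ℕ} → (∀ i → f i ≤ g i) → sum f ≤ sum g
sum-mono-≤ {zero}  f≤g = z≤n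
sum-mono-≤ {suc n} f≤g = +-mono-≤ (f≤g zero) (sum-mono-≤ (f≤g ∘ suc))

sum-mono-< : ∀ {n} {f g : Fin n → ℕ} (i : Fin n) →
             (∀ j → f j ≤ g j) → f i < g i → sum f < sum g
sum-mono-< zero    f≤g fi<gi = +-mono-<-≤ fi<gi (sum-mono-≤ (f≤g ∘ suc))
sum-mono-< (suc i) f≤g fi<gi = +-mono-≤-< (f≤g zero) (sum-mono-< i (f≤g ∘ suc) fi<gi)

sum-<⇒∃< : ∀ {n} (f g : Fin n → ℕ) → sum f < sum g → ∃ λ i → f i < g i
sum-<⇒∃< {zero}  f g ()
sum-<⇒∃< {suc n} f g Σf<Σg with f zero <? g zero
... | yes f0<g0 = zero , f0<g0
... | no  f0≮g0 =
  let (i , fi<gi) = sum-<⇒∃< (f ∘ suc) (g ∘ suc)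
                      (+-cancelˡ-< (g zero) _ _ (≤-<-trans (+-monoˡ-≤ _ (≮⇒≥ f0≮g0)) Σf<Σg))
  in suc i , fi<gi

sum-zero : ∀ {n} (f : Fin n → ℕ) → (∀ i → f i ≡ 0) → sum f ≡ 0
sum-zero {zero}  f f≡0 = refl
sum-zero {suc n} f f≡0 = cong₂ _+_ (f≡0 zero) (sum-zero (f ∘ suc) (f≡0 ∘ suc))

sum-supported-at : ∀ {n} (f : Fin n → ℕ) (i : Fin n) →
                   (∀ j → j ≢ i → f j ≡ 0) → sum f ≡ f i
sum-supported-at f zero    f≡0 =
  trans (cong (f zero +_) (sum-zero (f ∘ suc) (λ j → f≡0 (suc j) λ ())))
        (+-identityʳ (f zero))
sum-supported-at f (suc i) f≡0 =
  cong₂ _+_ (f≡0 zero λ ())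
            (sum-supported-at (f ∘ suc) i λ j j≢i → f≡0 (suc j) (j≢i ∘ Fin.suc-injective))

sum-one : ∀ n → sum {n} (λ _ → 1) ≡ n
sum-one zero    = refl
sum-one (suc n) = cong suc (sum-one n)

⌊⌋-true : ∀ {A : Set} (a? : Dec A) → A → ⌊ a? ⌋ ≡ true
⌊⌋-true (yes _) a = refl
⌊⌋-true (no ¬a) a = contradiction a ¬a

⌊⌋-false : ∀ {A : Set} (a? : Dec A) → ¬ A → ⌊ a? ⌋ ≡ false
⌊⌋-false (yes a) ¬a = contradiction a ¬a
⌊⌋-false (no _)  ¬a = refl

⌊⌋-true⁻ : ∀ {A : Set} (a? : Dec A) → ⌊ a? ⌋ ≡ true → A
⌊⌋-true⁻ (yes a) _ = a

contradictionᵇ : ∀ {b} {A : Set} → b ≡ true → b ≡ false → A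
contradictionᵇ refl ()

∧-true⁻ : ∀ a {b} → a ∧ b ≡ true → a ≡ true × b ≡ true
∧-true⁻ true b≡true = refl , b≡true

[_]*_ : Bool → ℕ → ℕ
[ b ]* c = if b then c else 0

[]*-mono : ∀ b {c d} → c ≤ d → [ b ]* c ≤ [ b ]* d
[]*-mono true  c≤d = c≤d
[]*-mono false c≤d = z≤n

Subsetᶠ : ℕ → Set
Subsetᶠ n = Fin n → Bool

module _ {n : ℕ} where

  ∅ : Subsetᶠ n
  ∅ _ = false

  ⁅_⁆ : Fin n → Subsetᶠ n
  ⁅ y ⁆ v = ⌊ v ≟ y ⌋

  infixr 6 _∪_
  infixr 7 _∩_ _∖_
  infix  4 _⊆_

  _∪_ _∩_ _∖_ : Subsetᶠ n → Subsetᶠ n → Subsetᶠ n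
  (A ∪ B) v = A v ∨ B v
  (A ∩ B) v = A v ∧ B v
  (A ∖ B) v = A v ∧ not (B v)

  _⊆_ : Subsetᶠ n → Subsetᶠ n → Set
  A ⊆ B = ∀ v → A v ≡ true → B v ≡ true

  ∖-true⁻ : ∀ A B {v} → (A ∖ B) v ≡ true → A v ≡ true × B v ≡ false
  ∖-true⁻ A B {v} v∈A∖B with A v | B v
  ... | true | false = refl , refl

  ∖-false⁻ : ∀ A B {v} → (A ∖ B) v ≡ false → B v ≡ false → A v ≡ false
  ∖-false⁻ A B {v} v∉A∖B v∉B rewrite v∉B = trans (sym (Bool.∧-identityʳ (A v))) v∉A∖B

  ∪-false⁻ : ∀ A B {v} → (A ∪ B) v ≡ false → A v ≡ false × B v ≡ false
  ∪-false⁻ A B {v} v∉A∪B with A v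
  ... | false = refl , v∉A∪B

  ⊆-∪ˡ : ∀ A B → A ⊆ A ∪ B
  ⊆-∪ˡ A B v v∈A rewrite v∈A = refl

  ⊆-∪ʳ : ∀ A B → B ⊆ A ∪ B
  ⊆-∪ʳ A B v v∈B rewrite v∈B = Bool.∨-zeroʳ (A v)

  ⊆-∩ : ∀ {A B C} → C ⊆ A → C ⊆ B → C ⊆ A ∩ B
  ⊆-∩ C⊆A C⊆B v v∈C rewrite C⊆A v v∈C = C⊆B v v∈C

  ∖-monoˡ : ∀ {A B} F → A ⊆ B → A ∖ F ⊆ B ∖ F
  ∖-monoˡ {A} F A⊆B v v∈A∖F with A v in v∈A
  ... | true rewrite A⊆B v v∈A = v∈A∖F

  ∖-monoʳ : ∀ A {F F′} → F ⊆ F′ → A ∖ F′ ⊆ A ∖ F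
  ∖-monoʳ A {F} F⊆F′ v v∈A∖F′ with A v | F v in v∈F
  ... | true | false = refl
  ... | true | true rewrite F⊆F′ v v∈F = v∈A∖F′

  ∪-∖ : ∀ A B F → (A ∪ B) ∖ F ⊆ (A ∖ F) ∪ (B ∖ F)
  ∪-∖ A B F v v∈[A∪B]∖F with A v | B v | F v
  ... | true  | _     | false = refl
  ... | false | true  | false = refl

  ⊆-∪-∖ : ∀ A F → A ⊆ F ∪ (A ∖ F)
  ⊆-∪-∖ A F v v∈A with F v
  ... | true  = refl
  ... | false rewrite v∈A = refl

  ∖-⊆-∖∪⁅⁆ : ∀ A F z → A ∖ F ⊆ (A ∖ (F ∪ ⁅ z ⁆)) ∪ ⁅ z ⁆
  ∖-⊆-∖∪⁅⁆ A F z v v∈A∖F with A v | F v | ⁅ z ⁆ v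
  ... | true | false | true  = Bool.∨-zeroʳ false
  ... | true | false | false = refl

  y∈⁅y⁆ : ∀ y → ⁅ y ⁆ y ≡ true
  y∈⁅y⁆ y = ⌊⌋-true (y ≟ y) refl

  v∉⁅y⁆ : ∀ {v y} → v ≢ y → ⁅ y ⁆ v ≡ false
  v∉⁅y⁆ {v} {y} = ⌊⌋-false (v ≟ y)

  v∈⁅y⁆⇒v≡y : ∀ {v y} → ⁅ y ⁆ v ≡ true → v ≡ y
  v∈⁅y⁆⇒v≡y {v} {y} = ⌊⌋-true⁻ (v ≟ y)

  weight : (Fin n → ℕ) → Subsetᶠ n → ℕ
  weight w S = sum λ v → [ S v ]* w v

  card : Subsetᶠ n → ℕ
  card = weight λ _ → 1

  weight-cong : ∀ w {A B : Subsetᶠ n} → (∀ v → A v ≡ B v) → weight w A ≡ weight w B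
  weight-cong w A≗B = sum-cong-≗ λ v → cong ([_]* w v) (A≗B v)

  weight-monoʳ-⊆ : ∀ w {A B : Subsetᶠ n} → A ⊆ B → weight w A ≤ weight w B
  weight-monoʳ-⊆ w {A} {B} A⊆B = sum-mono-≤ pointwise
    where
    pointwise : ∀ v → [ A v ]* w v ≤ [ B v ]* w v
    pointwise v with A v in Av
    ... | false = z≤n
    ... | true  rewrite A⊆B v Av = ≤-refl

  weight-∪-∩ : ∀ w (A B : Subsetᶠ n) →
               weight w (A ∪ B) + weight w (A ∩ B) ≡ weight w A + weight w B
  weight-∪-∩ w A B = begin
    weight w (A ∪ B) + weight w (A ∩ B)
      ≡⟨ ∑-distrib-+ (λ v → [ A v ∨ B v ]* w v) (λ v → [ A v ∧ B v ]* w v) ⟨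
    sum (λ v → [ A v ∨ B v ]* w v + [ A v ∧ B v ]* w v)
      ≡⟨ sum-cong-≗ (λ v → pointwise (A v) (B v) (w v)) ⟩
    sum (λ v → [ A v ]* w v + [ B v ]* w v)
      ≡⟨ ∑-distrib-+ (λ v → [ A v ]* w v) (λ v → [ B v ]* w v) ⟩
    weight w A + weight w B
      ∎
    where
    open ≡-Reasoning
    pointwise : ∀ a b c → [ a ∨ b ]* c + [ a ∧ b ]* c ≡ [ a ]* c + [ b ]* c
    pointwise true  true  c = refl
    pointwise true  false c = refl
    pointwise false true  c = +-comm c 0
    pointwise false false c = refl

  weight-∪ : ∀ w (A B : Subsetᶠ n) → weight w (A ∪ B) ≤ weight w A + weight w B
  weight-∪ w A B = ≤-trans (m≤m+n _ _) (≤-reflexive (weight-∪-∩ w A B))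

  weight-∅ : ∀ w {A : Subsetᶠ n} → (∀ v → A v ≡ false) → weight w A ≡ 0
  weight-∅ w A≡∅ = sum-zero _ λ v → cong ([_]* w v) (A≡∅ v)

  weight-⁅⁆ : ∀ w y → weight w ⁅ y ⁆ ≡ w y
  weight-⁅⁆ w y = trans (sum-supported-at _ y λ v v≢y → cong ([_]* w v) (v∉⁅y⁆ v≢y))
                        (cong ([_]* w y) (y∈⁅y⁆ y))

  weight-insert : ∀ w {S : Subsetᶠ n} {y} → S y ≡ false →
                  weight w (S ∪ ⁅ y ⁆) ≡ weight w S + w y
  weight-insert w {S} {y} y∉S = begin
    weight w (S ∪ ⁅ y ⁆)                          ≡⟨ +-identityʳ _ ⟨
    weight w (S ∪ ⁅ y ⁆) + 0                      ≡⟨ cong (weight w (S ∪ ⁅ y ⁆) +_) weight-S∩⁅y⁆ ⟨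
    weight w (S ∪ ⁅ y ⁆) + weight w (S ∩ ⁅ y ⁆)   ≡⟨ weight-∪-∩ w S ⁅ y ⁆ ⟩
    weight w S + weight w ⁅ y ⁆                   ≡⟨ cong (weight w S +_) (weight-⁅⁆ w y) ⟩
    weight w S + w y                              ∎
    where
    open ≡-Reasoning
    S∩⁅y⁆≡∅ : ∀ v → (S ∩ ⁅ y ⁆) v ≡ false
    S∩⁅y⁆≡∅ v with v ≟ y
    ... | yes refl rewrite y∉S = refl
    ... | no  _    = Bool.∧-zeroʳ (S v)
    weight-S∩⁅y⁆ : weight w (S ∩ ⁅ y ⁆) ≡ 0
    weight-S∩⁅y⁆ = weight-∅ w S∩⁅y⁆≡∅

  weight-⊆-∪-∩ : ∀ w {P Q A B : Subsetᶠ n} → P ⊆ A ∪ B → Q ⊆ A ∩ B →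
                 weight w P + weight w Q ≤ weight w A + weight w B
  weight-⊆-∪-∩ w {A = A} {B} P⊆A∪B Q⊆A∩B =
    ≤-trans (+-mono-≤ (weight-monoʳ-⊆ w P⊆A∪B) (weight-monoʳ-⊆ w Q⊆A∩B))
            (≤-reflexive (weight-∪-∩ w A B))

  card-insert : ∀ {S : Subsetᶠ n} {y} → S y ≡ false → card (S ∪ ⁅ y ⁆) ≡ suc (card S)
  card-insert {S} y∉S = trans (weight-insert (λ _ → 1) y∉S) (+-comm (card S) 1)

  weight-≤-*card : ∀ {w} K → (∀ v → w v ≤ K) → ∀ S → weight w S ≤ K * card S
  weight-≤-*card {w} K w≤K S =
    ≤-trans (sum-mono-≤ pointwise) (≤-reflexive (sym (*-distribˡ-sum K (λ v → [ S v ]* 1))))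
    where
    pointwise : ∀ v → [ S v ]* w v ≤ K * [ S v ]* 1
    pointwise v with S v
    ... | true  = ≤-trans (w≤K v) (≤-reflexive (sym (*-identityʳ K)))
    ... | false = ≤-reflexive (sym (*-zeroʳ K))

  *card-≤-weight : ∀ {w} K → (∀ v → K ≤ w v) → ∀ S → K * card S ≤ weight w S
  *card-≤-weight {w} K K≤w S =
    ≤-trans (≤-reflexive (*-distribˡ-sum K (λ v → [ S v ]* 1))) (sum-mono-≤ pointwise)
    where
    pointwise : ∀ v → K * [ S v ]* 1 ≤ [ S v ]* w v
    pointwise v with S v
    ... | true  = ≤-trans (≤-reflexive (*-identityʳ K)) (K≤w v)
    ... | false = ≤-reflexive (*-zeroʳ K)

  weight-monoˡ-≤ : ∀ {w w′} (S : Subsetᶠ n) → (∀ v → w′ v ≤ w v) → weight w′ S ≤ weight w S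
  weight-monoˡ-≤ S w′≤w = sum-mono-≤ λ v → []*-mono (S v) (w′≤w v)

  weight-monoˡ-< : ∀ {w w′} {S : Subsetᶠ n} a → (∀ v → w′ v ≤ w v) →
                   S a ≡ true → w′ a < w a → weight w′ S < weight w S
  weight-monoˡ-< {w} {w′} {S} a w′≤w a∈S w′a<wa =
    sum-mono-< a (λ v → []*-mono (S v) (w′≤w v))
      (subst (λ b → [ b ]* w′ a < [ b ]* w a) (sym a∈S) w′a<wa)

∣∣≡card : ∀ {n} (S : Subset n) → ∣ S ∣ ≡ card (lookup S)
∣∣≡card []          = refl
∣∣≡card (true  ∷ S) = cong suc (∣∣≡card S)
∣∣≡card (false ∷ S) = ∣∣≡card S

∣tabulate∣≡card : ∀ {n} (A : Subsetᶠ n) → ∣ tabulate A ∣ ≡ card A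
∣tabulate∣≡card A = trans (∣∣≡card (tabulate A)) (weight-cong _ (lookup∘tabulate A))

lookup-─ : ∀ {n} (A B : Subset n) v → lookup (A ─ B) v ≡ (lookup A ∖ lookup B) v
lookup-─ (a ∷ A) (true  ∷ B) zero    = sym (Bool.∧-zeroʳ a)
lookup-─ (a ∷ A) (false ∷ B) zero    = sym (Bool.∧-identityʳ a)
lookup-─ (a ∷ A) (b     ∷ B) (suc v) = lookup-─ A B v

∣tabulate─tabulate∣ : ∀ {n} (A B : Subsetᶠ n) → ∣ tabulate A ─ tabulate B ∣ ≡ card (A ∖ B)
∣tabulate─tabulate∣ A B = trans (∣∣≡card (tabulate A ─ tabulate B)) (weight-cong _ λ v →
  trans (lookup-─ (tabulate A) (tabulate B) v)
        (cong₂ (λ a b → a ∧ not b) (lookup∘tabulate A v) (lookup∘tabulate B v)))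

anyFin⁺ : ∀ {k} (f : Fin k → Bool) i → f i ≡ true → anyFin f ≡ true
anyFin⁺ f zero    fi≡true rewrite fi≡true = refl
anyFin⁺ f (suc i) fi≡true with f zero
... | true  = refl
... | false = anyFin⁺ (f ∘ suc) i fi≡true

anyFin⁻ : ∀ {k} (f : Fin k → Bool) → anyFin f ≡ true → ∃ λ i → f i ≡ true
anyFin⁻ {suc k} f any≡true with f zero in f0
... | true  = zero , f0
... | false = let (i , fi) = anyFin⁻ (f ∘ suc) any≡true in suc i , fi

anyFin-cong : ∀ {k} {f g : Fin k → Bool} → (∀ i → f i ≡ g i) → anyFin f ≡ anyFin g
anyFin-cong {zero}  f≗g = refl
anyFin-cong {suc k} f≗g = cong₂ _∨_ (f≗g zero) (anyFin-cong (f≗g ∘ suc))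

anyFin-false : ∀ {k} (f : Fin k → Bool) → (∀ i → f i ≡ false) → anyFin f ≡ false
anyFin-false {zero}  f f≡false = refl
anyFin-false {suc k} f f≡false rewrite f≡false zero = anyFin-false (f ∘ suc) (f≡false ∘ suc)

module Neighbourhood {n : ℕ} (G : Graph n) where

  N : Subsetᶠ n → Subsetᶠ n
  N S v = anyFin λ u → S u ∧ adj G u v

  lookup-Γ : ∀ S v → lookup (Γ G S) v ≡ N (lookup S) v
  lookup-Γ S = lookup∘tabulate (N (lookup S))

  N⁺ : ∀ {S u v} → S u ≡ true → adj G u v ≡ true → N S v ≡ true
  N⁺ {u = u} u∈S uv = anyFin⁺ _ u (cong₂ _∧_ u∈S uv)

  N⁻ : ∀ {S v} → N S v ≡ true → ∃ λ u → S u ≡ true × adj G u v ≡ true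
  N⁻ {S} {v} v∈NS with anyFin⁻ _ v∈NS
  ... | u , p = u , ∧-true⁻ (S u) p

  N-cong : ∀ {A B} → (∀ v → A v ≡ B v) → ∀ v → N A v ≡ N B v
  N-cong A≗B v = anyFin-cong λ u → cong (_∧ adj G u v) (A≗B u)

  N-mono : ∀ {A B} → A ⊆ B → N A ⊆ N B
  N-mono A⊆B v v∈NA = let (u , u∈A , uv) = N⁻ v∈NA in N⁺ (A⊆B u u∈A) uv

  N-∪ : ∀ A B → N (A ∪ B) ⊆ N A ∪ N B
  N-∪ A B v v∈N[A∪B] with N⁻ {A ∪ B} v∈N[A∪B]
  ... | u , u∈A∪B , uv with A u in u∈A
  ...   | true  = ⊆-∪ˡ (N A) (N B) v (N⁺ u∈A uv)
  ...   | false = ⊆-∪ʳ (N A) (N B) v (N⁺ {B} u∈A∪B uv)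

  ∣Γ-tabulate∣ : ∀ A → ∣ Γ G (tabulate A) ∣ ≡ card (N A)
  ∣Γ-tabulate∣ A = trans (∣∣≡card (Γ G (tabulate A)))
                         (weight-cong _ λ v → trans (lookup-Γ (tabulate A) v) (N-cong (lookup∘tabulate A) v))

  N-expansion : ∀ {m K} → (∀ (S : Subset n) → m ≤ ∣ S ∣ → ∣ S ∣ ≤ 2 * m → K ≤ ∣ Γ G S ∣) →
                ∀ A → m ≤ card A → card A ≤ 2 * m → K ≤ card (N A)
  N-expansion {m} {K} expansion A m≤∣A∣ ∣A∣≤2m = subst (K ≤_) (∣Γ-tabulate∣ A)
    (expansion (tabulate A) (subst (m ≤_) (sym (∣tabulate∣≡card A)) m≤∣A∣)
                            (subst (_≤ 2 * m) (sym (∣tabulate∣≡card A)) ∣A∣≤2m))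

  freeNbrs : Subsetᶠ n → Subsetᶠ n → ℕ
  freeNbrs F S = card (N S ∖ F)

  freeNbrs-cong : ∀ F {A B} → (∀ v → A v ≡ B v) → freeNbrs F A ≡ freeNbrs F B
  freeNbrs-cong F A≗B = weight-cong _ λ v → cong (_∧ not (F v)) (N-cong A≗B v)

  ∣Γ─tabulate∣ : ∀ S B → ∣ Γ G S ─ tabulate B ∣ ≡ freeNbrs B (lookup S)
  ∣Γ─tabulate∣ S B = trans (∣∣≡card (Γ G S ─ tabulate B)) (weight-cong _ λ v →
    trans (lookup-─ (Γ G S) (tabulate B) v)
          (cong₂ (λ a b → a ∧ not b) (lookup-Γ S v) (lookup∘tabulate B v)))

  freeNbrs-antitone : ∀ {F F′} → F ⊆ F′ → ∀ S → freeNbrs F′ S ≤ freeNbrs F S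
  freeNbrs-antitone F⊆F′ S = weight-monoʳ-⊆ _ (∖-monoʳ (N S) F⊆F′)

  freeNbrs-∅ : ∀ F → freeNbrs F ∅ ≡ 0
  freeNbrs-∅ F = weight-∅ _ λ v → cong (_∧ not (F v)) (N∅ v)
    where
    N∅ : ∀ v → N ∅ v ≡ false
    N∅ v = anyFin-false {n} _ λ _ → refl

  freeNbrs-submodular : ∀ F A B →
    freeNbrs F (A ∪ B) + freeNbrs F (A ∩ B) ≤ freeNbrs F A + freeNbrs F B
  freeNbrs-submodular F A B = weight-⊆-∪-∩ _
    (λ v v∈ → ∪-∖ (N A) (N B) F v (∖-monoˡ F (N-∪ A B) v v∈))
    (⊆-∩ (∖-monoˡ F (N-mono λ u → proj₁ ∘ ∧-true⁻ (A u)))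
         (∖-monoˡ F (N-mono λ u → proj₂ ∘ ∧-true⁻ (A u))))

  freeNbrs-∪ : ∀ F A B → freeNbrs F (A ∪ B) ≤ freeNbrs F A + freeNbrs F B
  freeNbrs-∪ F A B = ≤-trans (m≤m+n _ _) (freeNbrs-submodular F A B)

  card-N≤ : ∀ F S → card (N S) ≤ card F + freeNbrs F S
  card-N≤ F S = ≤-trans (weight-monoʳ-⊆ _ (⊆-∪-∖ (N S) F)) (weight-∪ _ F (N S ∖ F))

  freeNbrs-insert : ∀ F S z → freeNbrs F S ≤ suc (freeNbrs (F ∪ ⁅ z ⁆) S)
  freeNbrs-insert F S z = begin
    freeNbrs F S                         ≤⟨ weight-monoʳ-⊆ _ (∖-⊆-∖∪⁅⁆ (N S) F z) ⟩
    card (N S ∖ (F ∪ ⁅ z ⁆) ∪ ⁅ z ⁆)     ≤⟨ weight-∪ _ (N S ∖ (F ∪ ⁅ z ⁆)) ⁅ z ⁆ ⟩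
    freeNbrs (F ∪ ⁅ z ⁆) S + card ⁅ z ⁆  ≡⟨ cong (freeNbrs (F ∪ ⁅ z ⁆) S +_) (weight-⁅⁆ _ z) ⟩
    freeNbrs (F ∪ ⁅ z ⁆) S + 1           ≡⟨ +-comm _ 1 ⟩
    suc (freeNbrs (F ∪ ⁅ z ⁆) S)         ∎
    where open ≤-Reasoning

  freeNbrs-insert-∉ : ∀ F S z → N S z ≡ false → freeNbrs F S ≤ freeNbrs (F ∪ ⁅ z ⁆) S
  freeNbrs-insert-∉ F S z z∉NS = weight-monoʳ-⊆ _ NS∖F⊆NS∖F′
    where
    NS∖F⊆NS∖F′ : N S ∖ F ⊆ N S ∖ (F ∪ ⁅ z ⁆)
    NS∖F⊆NS∖F′ v v∈ with v ≟ z
    ... | yes refl rewrite z∉NS = v∈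
    ... | no  _    rewrite Bool.∨-identityʳ (F v) = v∈

allSubsets : ∀ n → List (Subset n)
allSubsets zero    = [] ∷ []
allSubsets (suc n) = map (true ∷_) (allSubsets n) ++ map (false ∷_) (allSubsets n)

∈-allSubsets : ∀ {n} (S : Subset n) → S ∈ allSubsets n
∈-allSubsets []          = here refl
∈-allSubsets (true  ∷ S) = ∈-++⁺ˡ (∈-map⁺ (true ∷_) (∈-allSubsets S))
∈-allSubsets (false ∷ S) = ∈-++⁺ʳ (map (true ∷_) (allSubsets _)) (∈-map⁺ (false ∷_) (∈-allSubsets S))

⋃ : ∀ {n} → List (Subset n) → Subsetᶠ n
⋃ []      = ∅
⋃ (A ∷ L) = lookup A ∪ ⋃ L

∈⇒⊆⋃ : ∀ {n} {A : Subset n} {L} → A ∈ L → lookup A ⊆ ⋃ L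
∈⇒⊆⋃ {A = A} {A ∷ L} (here refl) = ⊆-∪ˡ (lookup A) (⋃ L)
∈⇒⊆⋃ {L = B ∷ L} (there A∈L) v v∈A = ⊆-∪ʳ (lookup B) (⋃ L) v (∈⇒⊆⋃ A∈L v v∈A)

module Largest {n : ℕ} (P : Subsetᶠ n → Set) (P? : ∀ S → Dec (P S))
  (P-cong : ∀ {A B} → (∀ v → A v ≡ B v) → P A → P B)
  (P-∅ : P ∅) (P-∪ : ∀ {A B} → P A → P B → P (A ∪ B)) where

  private
    members : List (Subset n)
    members = filter (P? ∘ lookup) (allSubsets n)

    P-⋃ : ∀ {L} → All (P ∘ lookup) L → P (⋃ L)
    P-⋃ []         = P-∅
    P-⋃ (PA ∷ PL) = P-∪ PA (P-⋃ PL)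

  largest : ∃ λ U → P U × (∀ B → P B → B ⊆ U)
  largest = ⋃ members , P-⋃ (all-filter (P? ∘ lookup) (allSubsets n)) , U-max
    where
    U-max : ∀ B → P B → B ⊆ ⋃ members
    U-max B PB v v∈B =
      ∈⇒⊆⋃ (∈-filter⁺ (P? ∘ lookup) (∈-allSubsets (tabulate B)) (P-cong (sym ∘ lookup∘tabulate B) PB))
        v (trans (lookup∘tabulate B v) v∈B)

card-<⇒∃ : ∀ {n} {A B : Subsetᶠ n} → card A < card B → ∃ λ v → A v ≡ false × B v ≡ true
card-<⇒∃ {A = A} {B} ∣A∣<∣B∣ with sum-<⇒∃< _ _ ∣A∣<∣B∣
... | v , Av<Bv with A v in v∉A | B v in v∈B
...   | false | true = v , v∉A , v∈B
...   | true  | true = ⊥-elim (<-irrefl refl Av<Bv)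

2Δm+2Δm<10Δm : ∀ {Δ m} → 1 ≤ Δ → 1 ≤ m → 2 * Δ * m + 2 * Δ * m < 10 * Δ * m
2Δm+2Δm<10Δm {Δ} {m} 1≤Δ 1≤m = begin-strict
  2 * Δ * m + 2 * Δ * m  ≡⟨ *-distribʳ-+ m (2 * Δ) (2 * Δ) ⟨
  (2 * Δ + 2 * Δ) * m    ≡⟨ cong (_* m) (*-distribʳ-+ Δ 2 2) ⟨
  4 * Δ * m              <⟨ *-monoˡ-< m {{>-nonZero 1≤m}} (*-monoˡ-< Δ {{>-nonZero 1≤Δ}} {4} {10} (m<m+n 4 z<s)) ⟩
  10 * Δ * m             ∎
  where open ≤-Reasoning

-- Move one unit of weight away from y (its edge to z is now used) and give
-- the newly used vertex z the weight c.
reweight : ∀ {n} → (Fin n → ℕ) → Fin n → Fin n → ℕ → Fin n → ℕ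
reweight w y z c = updateAt (updateAt w y (_∸ 1)) z λ _ → c

module _ {n} (w : Fin n → ℕ) {y z : Fin n} (c : ℕ) (z≢y : z ≢ y) where

  reweight-z : reweight w y z c z ≡ c
  reweight-z = updateAt-updates z (updateAt w y (_∸ 1))

  reweight-y : reweight w y z c y ≡ w y ∸ 1
  reweight-y = trans (updateAt-minimal y z (updateAt w y (_∸ 1)) (z≢y ∘ sym)) (updateAt-updates y w)

  reweight-other : ∀ {v} → v ≢ z → v ≢ y → reweight w y z c v ≡ w v
  reweight-other v≢z v≢y = trans (updateAt-minimal _ z (updateAt w y (_∸ 1)) v≢z) (updateAt-minimal _ y w v≢y)

  reweight-ind : (P : Fin n → ℕ → Set) → P z c → P y (w y ∸ 1) →
                 (∀ v → v ≢ z → v ≢ y → P v (w v)) → ∀ v → P v (reweight w y z c v)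
  reweight-ind P Pz Py Pother v with v ≟ z | v ≟ y
  ... | yes refl | _        = subst (P z) (sym reweight-z) Pz
  ... | no  v≢z  | yes refl = subst (P y) (sym reweight-y) Py
  ... | no  v≢z  | no  v≢y  = subst (P v) (sym (reweight-other v≢z v≢y)) (Pother v v≢z v≢y)

module Goodness {n : ℕ} (G : Graph n) (Δ m : ℕ) where

  open Neighbourhood G

  Good : Subsetᶠ n → (Fin n → ℕ) → Set
  Good F w = ∀ S → card S ≤ m → weight w S ≤ freeNbrs F S

  record Invariant (F : Subsetᶠ n) (w : Fin n → ℕ) : Set where
    field
      good      : Good F w
      w≤2Δ      : ∀ v → w v ≤ 2 * Δ
      Δ≤w       : ∀ v → Δ ≤ w v
      unused⇒2Δ : ∀ v → F v ≡ false → 2 * Δ ≤ w v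

module Extension {n : ℕ} (G : Graph n) (Δ M m : ℕ) (1≤Δ : 1 ≤ Δ) (1≤m : 1 ≤ m)
  (expansion : ∀ S → m ≤ card S → card S ≤ 2 * m → M + 10 * Δ * m ≤ card (Neighbourhood.N G S))
  where

  open Neighbourhood G
  open Goodness G Δ m public

  module Witness {F w} (good : Good F w) (w≤2Δ : ∀ v → w v ≤ 2 * Δ) (∣F∣≤M : card F ≤ M)
           {y} (y∈F : F y ≡ true) (1≤wy : 1 ≤ w y) where

    weight≤2Δm : ∀ S → card S ≤ m → weight w S ≤ 2 * Δ * m
    weight≤2Δm S ∣S∣≤m = ≤-trans (weight-≤-*card (2 * Δ) w≤2Δ S) (*-monoʳ-≤ (2 * Δ) ∣S∣≤m)

    Tight : Subsetᶠ n → Set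
    Tight S = card S ≤ m × S y ≡ false × freeNbrs F S ≤ weight w S

    Tight? : ∀ S → Dec (Tight S)
    Tight? S = card S ≤? m ×-dec (S y Bool.≟ false) ×-dec (freeNbrs F S ≤? weight w S)

    Tight-cong : ∀ {A B} → (∀ v → A v ≡ B v) → Tight A → Tight B
    Tight-cong A≗B (∣A∣≤m , y∉A , tight) =
      subst (_≤ m) (weight-cong _ A≗B) ∣A∣≤m , trans (sym (A≗B y)) y∉A ,
      subst₂ _≤_ (freeNbrs-cong F A≗B) (weight-cong w A≗B) tight

    Tight-∅ : Tight ∅
    Tight-∅ = subst (_≤ m) (sym (weight-∅ {n} (λ _ → 1) λ _ → refl)) z≤n , refl ,
              subst (_≤ weight w ∅) (sym (freeNbrs-∅ F)) z≤n

    Tight-∪ : ∀ {A B} → Tight A → Tight B → Tight (A ∪ B)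
    Tight-∪ {A} {B} (∣A∣≤m , y∉A , A-tight) (∣B∣≤m , y∉B , B-tight) =
      ∣A∪B∣≤m , cong₂ _∨_ y∉A y∉B , A∪B-tight
      where
      ∣A∪B∣≤2m : card (A ∪ B) ≤ 2 * m
      ∣A∪B∣≤2m = ≤-trans (weight-∪ _ A B)
                   (≤-trans (+-mono-≤ ∣A∣≤m ∣B∣≤m) (≤-reflexive (cong (m +_) (sym (+-identityʳ m)))))

      -- A union of more than m vertices would be forced to expand beyond
      -- the total weight of A and B.
      ∣A∪B∣≤m : card (A ∪ B) ≤ m
      ∣A∪B∣≤m with card (A ∪ B) ≤? m
      ... | yes ∣A∪B∣≤m = ∣A∪B∣≤m
      ... | no  ∣A∪B∣≰m = ⊥-elim (<⇒≱ (2Δm+2Δm<10Δm 1≤Δ 1≤m) (+-cancelˡ-≤ M _ _ (begin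
        M + 10 * Δ * m                     ≤⟨ expansion (A ∪ B) (≰⇒≥ ∣A∪B∣≰m) ∣A∪B∣≤2m ⟩
        card (N (A ∪ B))                   ≤⟨ card-N≤ F (A ∪ B) ⟩
        card F + freeNbrs F (A ∪ B)        ≤⟨ +-mono-≤ ∣F∣≤M (freeNbrs-∪ F A B) ⟩
        M + (freeNbrs F A + freeNbrs F B)  ≤⟨ +-monoʳ-≤ M (+-mono-≤ (≤-trans A-tight (weight≤2Δm A ∣A∣≤m))
                                                                   (≤-trans B-tight (weight≤2Δm B ∣B∣≤m))) ⟩
        M + (2 * Δ * m + 2 * Δ * m)        ∎)))
        where open ≤-Reasoning

      A∪B-tight : freeNbrs F (A ∪ B) ≤ weight w (A ∪ B)
      A∪B-tight = +-cancelʳ-≤ (freeNbrs F (A ∩ B)) _ _ (begin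
        freeNbrs F (A ∪ B) + freeNbrs F (A ∩ B)  ≤⟨ freeNbrs-submodular F A B ⟩
        freeNbrs F A + freeNbrs F B              ≤⟨ +-mono-≤ A-tight B-tight ⟩
        weight w A + weight w B                  ≡⟨ weight-∪-∩ w A B ⟨
        weight w (A ∪ B) + weight w (A ∩ B)      ≤⟨ +-monoʳ-≤ _ (good (A ∩ B) ∣A∩B∣≤m) ⟩
        weight w (A ∪ B) + freeNbrs F (A ∩ B)    ∎)
        where
        open ≤-Reasoning
        ∣A∩B∣≤m : card (A ∩ B) ≤ m
        ∣A∩B∣≤m = ≤-trans (weight-monoʳ-⊆ _ λ v → proj₁ ∘ ∧-true⁻ (A v)) ∣A∣≤m

    open Largest Tight Tight? Tight-cong Tight-∅ Tight-∪ using (largest)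

    private
      U : Subsetᶠ n
      U = proj₁ largest

      ∣U∣≤m : card U ≤ m
      ∣U∣≤m = proj₁ (proj₁ (proj₂ largest))

      y∉U : U y ≡ false
      y∉U = proj₁ (proj₂ (proj₁ (proj₂ largest)))

      U-tight : freeNbrs F U ≤ weight w U
      U-tight = proj₂ (proj₂ (proj₁ (proj₂ largest)))

      Tight⇒⊆U : ∀ S → Tight S → S ⊆ U
      Tight⇒⊆U = proj₂ (proj₂ largest)

      -- Adding y to the largest tight set strictly increases its free
      -- neighbourhood: below size m by Good, at size m by expansion.
      freeNbrs-U<U∪y : freeNbrs F U < freeNbrs F (U ∪ ⁅ y ⁆)
      freeNbrs-U<U∪y with card U <? m
      ... | yes ∣U∣<m = begin-strict
        freeNbrs F U            ≤⟨ U-tight ⟩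
        weight w U              <⟨ m<m+n _ 1≤wy ⟩
        weight w U + w y        ≡⟨ weight-insert w {S = U} y∉U ⟨
        weight w (U ∪ ⁅ y ⁆)    ≤⟨ good (U ∪ ⁅ y ⁆) ∣U∪y∣≤m ⟩
        freeNbrs F (U ∪ ⁅ y ⁆)  ∎
        where
        open ≤-Reasoning
        ∣U∪y∣≤m : card (U ∪ ⁅ y ⁆) ≤ m
        ∣U∪y∣≤m = subst (_≤ m) (sym (card-insert {S = U} y∉U)) ∣U∣<m
      ... | no  ∣U∣≮m = begin-strict
        freeNbrs F U            ≤⟨ U-tight ⟩
        weight w U              ≤⟨ weight≤2Δm U ∣U∣≤m ⟩
        2 * Δ * m               ≤⟨ m≤m+n _ _ ⟩
        2 * Δ * m + 2 * Δ * m   <⟨ 2Δm+2Δm<10Δm 1≤Δ 1≤m ⟩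
        10 * Δ * m              ≤⟨ +-cancelˡ-≤ M _ _ (begin
          M + 10 * Δ * m                 ≤⟨ expansion (U ∪ ⁅ y ⁆) m≤∣U∪y∣ ∣U∪y∣≤2m ⟩
          card (N (U ∪ ⁅ y ⁆))           ≤⟨ card-N≤ F (U ∪ ⁅ y ⁆) ⟩
          card F + freeNbrs F (U ∪ ⁅ y ⁆) ≤⟨ +-monoˡ-≤ _ ∣F∣≤M ⟩
          M + freeNbrs F (U ∪ ⁅ y ⁆)      ∎) ⟩
        freeNbrs F (U ∪ ⁅ y ⁆)  ∎
        where
        open ≤-Reasoning
        m≤∣U∪y∣ : m ≤ card (U ∪ ⁅ y ⁆)
        m≤∣U∪y∣ = ≤-trans (≮⇒≥ ∣U∣≮m)
                    (≤-trans (n≤1+n _) (≤-reflexive (sym (card-insert {S = U} y∉U))))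
        ∣U∪y∣≤2m : card (U ∪ ⁅ y ⁆) ≤ 2 * m
        ∣U∪y∣≤2m = subst (_≤ 2 * m) (sym (card-insert {S = U} y∉U))
                     (+-mono-≤ 1≤m (≤-trans ∣U∣≤m (≤-reflexive (sym (+-identityʳ m)))))

      -- Opaque: unfolding this witness during type checking is prohibitively
      -- slow, and nothing needs to compute with it.
      opaque
        z-spec : ∃ λ z → (N U ∖ F) z ≡ false × (N (U ∪ ⁅ y ⁆) ∖ F) z ≡ true
        z-spec = card-<⇒∃ freeNbrs-U<U∪y

    z : Fin n
    z = proj₁ z-spec

    z∉F : F z ≡ false
    z∉F = proj₂ (∖-true⁻ (N (U ∪ ⁅ y ⁆)) F (proj₂ (proj₂ z-spec)))

    private
      z∉NU : N U z ≡ false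
      z∉NU = ∖-false⁻ (N U) F (proj₁ (proj₂ z-spec)) z∉F

      z∈N⁅y⁆ : N ⁅ y ⁆ z ≡ true
      z∈N⁅y⁆ with N-∪ U ⁅ y ⁆ z (proj₁ (∖-true⁻ (N (U ∪ ⁅ y ⁆)) F (proj₂ (proj₂ z-spec))))
      ... | z∈NU∨N⁅y⁆ rewrite z∉NU = z∈NU∨N⁅y⁆

    yz : adj G y z ≡ true
    yz with N⁻ z∈N⁅y⁆
    ... | u , u∈⁅y⁆ , uz = subst (λ u → adj G u z ≡ true) (v∈⁅y⁆⇒v≡y u∈⁅y⁆) uz

    z≢y : z ≢ y
    z≢y z≡y = contradictionᵇ (trans (cong F z≡y) y∈F) z∉F

    module _ (c : ℕ) (c<wz : c < w z) where

      private
        w′ : Fin n → ℕ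
        w′ = reweight w y z c

        w′≤w : ∀ v → w′ v ≤ w v
        w′≤w = reweight-ind w c z≢y (λ v c′ → c′ ≤ w v) (<⇒≤ c<wz) (m∸n≤m (w y) 1)
                 λ _ _ _ → ≤-refl

        w′y<wy : w′ y < w y
        w′y<wy = subst (_< w y) (sym (reweight-y w c z≢y)) (∸-monoʳ-< {o = 0} (s≤s z≤n) 1≤wy)

        w′z<wz : w′ z < w z
        w′z<wz = subst (_< w z) (sym (reweight-z w c z≢y)) c<wz

        -- If z is a neighbour of S then either S meets {y, z}, where the
        -- weight drops, or S is not tight, by the maximality of U.
        w′<freeNbrs : ∀ S → card S ≤ m → N S z ≡ true → weight w′ S < freeNbrs F S
        w′<freeNbrs S ∣S∣≤m z∈NS with S y in y∈S | S z in z∈S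
        ... | true  | _     = <-≤-trans (weight-monoˡ-< y w′≤w y∈S w′y<wy) (good S ∣S∣≤m)
        ... | false | true  = <-≤-trans (weight-monoˡ-< z w′≤w z∈S w′z<wz) (good S ∣S∣≤m)
        ... | false | false with freeNbrs F S ≤? weight w S
        ...   | yes S-tight = contradictionᵇ (N-mono (Tight⇒⊆U S (∣S∣≤m , y∈S , S-tight)) z z∈NS) z∉NU
        ...   | no  S-loose = ≤-<-trans (weight-monoˡ-≤ S w′≤w) (≰⇒> S-loose)

      reweight-good : Good (F ∪ ⁅ z ⁆) (reweight w y z c)
      reweight-good S ∣S∣≤m with N S z in z∈NS
      ... | false = ≤-trans (weight-monoˡ-≤ S w′≤w)
                            (≤-trans (good S ∣S∣≤m) (freeNbrs-insert-∉ F S z z∈NS))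
      ... | true  = m<1+n⇒m≤n (<-≤-trans (w′<freeNbrs S ∣S∣≤m z∈NS) (freeNbrs-insert F S z))

  record GoodNeighbour (F : Subsetᶠ n) (w : Fin n → ℕ) (y : Fin n) : Set where
    field
      z             : Fin n
      yz            : adj G y z ≡ true
      z∉F           : F z ≡ false
      z≢y           : z ≢ y
      reweight-good : ∀ c → c < w z → Good (F ∪ ⁅ z ⁆) (reweight w y z c)

  extend : ∀ {F w} → Good F w → (∀ v → w v ≤ 2 * Δ) → card F ≤ M →
           ∀ {y} → F y ≡ true → 1 ≤ w y → GoodNeighbour F w y
  extend good w≤2Δ ∣F∣≤M y∈F 1≤wy = record { Witness good w≤2Δ ∣F∣≤M y∈F 1≤wy }

module _ (T : RootedTree) where

  -- The children suc j′ of a with j ≤ j′, i.e. those not among the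
  -- vertices 0, …, j.
  laterChildren : ℕ → V T → Subsetᶠ (k T)
  laterChildren j a j′ = ⌊ j ≤? toℕ j′ ⌋ ∧ ⌊ parent T j′ ≟ a ⌋

  pending : ℕ → V T → ℕ
  pending j a = card (laterChildren j a)

  pending-suc : ∀ j a → pending (suc j) a ≤ pending j a
  pending-suc j a = weight-monoʳ-⊆ _ later⊆
    where
    later⊆ : laterChildren (suc j) a ⊆ laterChildren j a
    later⊆ j′ j′∈ with suc j ≤? toℕ j′ | j ≤? toℕ j′
    ... | yes j<j′ | yes _   = j′∈
    ... | yes j<j′ | no j≰j′ = contradiction (<⇒≤ j<j′) j≰j′

  pending≤children : ∀ j a → pending j a ≤ children T a
  pending≤children j a = ≤-trans (weight-monoʳ-⊆ (λ _ → 1) {B = λ j′ → ⌊ parent T j′ ≟ a ⌋}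
                                   λ j′ → proj₂ ∘ ∧-true⁻ ⌊ j ≤? toℕ j′ ⌋)
                                 (≤-reflexive (sym (sumFin≡sum λ j′ → [ ⌊ parent T j′ ≟ a ⌋ ]* 1)))

  pending-parent : ∀ j′ → suc (pending (suc (toℕ j′)) (parent T j′)) ≤ pending (toℕ j′) (parent T j′)
  pending-parent j′ = ≤-trans (≤-reflexive (sym (card-insert {S = laterChildren (suc (toℕ j′)) p} j′∉later)))
                              (weight-monoʳ-⊆ _ later∪j′⊆)
    where
    p = parent T j′
    j′∉later : laterChildren (suc (toℕ j′)) p j′ ≡ false
    j′∉later with suc (toℕ j′) ≤? toℕ j′
    ... | yes j′<j′ = contradiction j′<j′ (<-irrefl refl)
    ... | no  _     = refl
    later∪j′⊆ : laterChildren (suc (toℕ j′)) p ∪ ⁅ j′ ⁆ ⊆ laterChildren (toℕ j′) p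
    later∪j′⊆ i i∈ with i ≟ j′
    ... | yes refl rewrite ⌊⌋-true (toℕ j′ ≤? toℕ j′) ≤-refl | ⌊⌋-true (p ≟ p) refl = refl
    ... | no  _ with suc (toℕ j′) ≤? toℕ i | toℕ j′ ≤? toℕ i
    ...   | yes j′<i | yes _    = trans (sym (Bool.∨-identityʳ _)) i∈
    ...   | yes j′<i | no j′≰i  = contradiction (<⇒≤ j′<i) j′≰i

toℕ≤0⇒≡zero : ∀ {k} (a : Fin (suc k)) → toℕ a ≤ 0 → a ≡ zero
toℕ≤0⇒≡zero zero    _  = refl
toℕ≤0⇒≡zero (suc a) ()

toℕ≤k : ∀ T (a : V T) → toℕ a ≤ k T
toℕ≤k T a = s≤s⁻¹ (Fin.toℕ<n a)

module TreeEmbedding {n : ℕ} (G : Graph n) (Δ M m : ℕ) (1≤Δ : 1 ≤ Δ) (1≤m : 1 ≤ m)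
  (expansion : ∀ S → m ≤ card S → card S ≤ 2 * m → M + 10 * Δ * m ≤ card (Neighbourhood.N G S))
  where

  open Neighbourhood G
  open Extension G Δ M m 1≤Δ 1≤m expansion

  module SingleTree (T : RootedTree) (ΔT≤Δ : MaxDegLe T Δ) (x : Fin n) {F₀ w₀} (inv₀ : Invariant F₀ w₀)
           (x∈F₀ : F₀ x ≡ true) (Δ+droot≤wx : Δ + droot T ≤ w₀ x) (budget : card F₀ + k T ≤ M)
           where

    -- The vertices 0, …, j of T embedded into G; the weight of each embedded
    -- vertex reserves one unit for every child still to be embedded.
    record PartialCopy (j : ℕ) : Set where
      field
        ψ         : V T → Fin n
        F         : Subsetᶠ n
        w         : Fin n → ℕ
        inv       : Invariant F w
        ∣F∣       : card F ≡ card F₀ + j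
        F₀⊆F      : F₀ ⊆ F
        root      : ψ zero ≡ x
        used      : ∀ a → toℕ a ≤ j → F (ψ a) ≡ true
        fresh     : ∀ a → toℕ a ≤ j → a ≢ zero → F₀ (ψ a) ≡ false
        injective : ∀ a b → toℕ a ≤ j → toℕ b ≤ j → ψ a ≡ ψ b → a ≡ b
        edge      : ∀ j′ → suc (toℕ j′) ≤ j → adj G (ψ (suc j′)) (ψ (parent T j′)) ≡ true
        reserve   : ∀ a → toℕ a ≤ j → Δ + pending T j a ≤ w (ψ a)
        keep      : ∀ v → F₀ v ≡ true → v ≢ x → w v ≡ w₀ v

    initial : PartialCopy 0
    initial = record
      { ψ = λ _ → x ; F = F₀ ; w = w₀ ; inv = inv₀ ; ∣F∣ = sym (+-identityʳ _) ; F₀⊆F = λ _ → id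
      ; root = refl ; used = λ _ _ → x∈F₀
      ; fresh = λ a a≤0 a≢0 → contradiction (toℕ≤0⇒≡zero a a≤0) a≢0
      ; injective = λ a b a≤0 b≤0 _ → trans (toℕ≤0⇒≡zero a a≤0) (sym (toℕ≤0⇒≡zero b b≤0))
      ; edge = λ _ ()
      ; reserve = λ a a≤0 → subst (λ a → Δ + pending T 0 a ≤ w₀ x) (sym (toℕ≤0⇒≡zero a a≤0))
                              (≤-trans (+-monoʳ-≤ Δ (pending≤children T 0 zero)) Δ+droot≤wx)
      ; keep = λ _ _ _ → refl
      }

    module Step (j′ : Fin (k T)) (s : PartialCopy (toℕ j′)) where

      open PartialCopy s
      open Invariant inv

      private
        j : ℕ
        j = toℕ j′

        p : V T
        p = parent T j′

        y : Fin n
        y = ψ p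

        p≤j : toℕ p ≤ j
        p≤j = parent< T j′

        y∈F : F y ≡ true
        y∈F = used p p≤j

        Δ<wy : Δ < w y
        Δ<wy = ≤-trans (≤-reflexive (+-comm 1 Δ))
                 (≤-trans (+-monoʳ-≤ Δ (≤-trans (s≤s z≤n) (pending-parent T j′))) (reserve p p≤j))

        ∣F∣≤M : card F ≤ M
        ∣F∣≤M = subst (_≤ M) (sym ∣F∣)
                  (≤-trans (+-monoʳ-≤ (card F₀) (<⇒≤ (Fin.toℕ<n j′))) budget)

        extension : GoodNeighbour F w y
        extension = extend good w≤2Δ ∣F∣≤M y∈F (≤-trans (s≤s z≤n) Δ<wy)

      open GoodNeighbour extension

      private

        c : ℕ
        c = Δ + children T (suc j′)

        c<2Δ : c < 2 * Δ
        c<2Δ = ≤-trans (≤-reflexive (sym (+-suc Δ _)))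
                 (+-monoʳ-≤ Δ (≤-trans (ΔT≤Δ (suc j′)) (≤-reflexive (sym (+-identityʳ Δ)))))

        ψ′ : V T → Fin n
        ψ′ = updateAt ψ (suc j′) λ _ → z

        w′ : Fin n → ℕ
        w′ = reweight w y z c

        ψ′-new : ψ′ (suc j′) ≡ z
        ψ′-new = updateAt-updates (suc j′) ψ

        ψ′-old : ∀ {a} → a ≢ suc j′ → ψ′ a ≡ ψ a
        ψ′-old {a} a≢new = updateAt-minimal a (suc j′) ψ a≢new

        old≢new : ∀ {a} → toℕ a ≤ j → a ≢ suc j′
        old≢new a≤j refl = 1+n≰n a≤j

        below : ∀ {a} → toℕ a ≤ suc j → a ≢ suc j′ → toℕ a ≤ j
        below a≤1+j a≢new = m<1+n⇒m≤n (≤∧≢⇒< a≤1+j (a≢new ∘ Fin.toℕ-injective))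

        ψ≢z : ∀ {a} → toℕ a ≤ j → ψ a ≢ z
        ψ≢z a≤j ψa≡z =
          contradictionᵇ (subst (λ v → F v ≡ true) ψa≡z (used _ a≤j)) z∉F

        z∉F₀ : F₀ z ≡ false
        z∉F₀ with F₀ z in z∈F₀
        ... | true  = contradictionᵇ (F₀⊆F z z∈F₀) z∉F
        ... | false = refl

        inv′ : Invariant (F ∪ ⁅ z ⁆) w′
        inv′ = record
          { good      = reweight-good c (<-≤-trans c<2Δ (unused⇒2Δ z z∉F))
          ; w≤2Δ      = reweight-ind w c z≢y (λ _ c′ → c′ ≤ 2 * Δ) (<⇒≤ c<2Δ)
                          (≤-trans (m∸n≤m (w y) 1) (w≤2Δ y)) (λ v _ _ → w≤2Δ v)
          ; Δ≤w       = reweight-ind w c z≢y (λ _ c′ → Δ ≤ c′) (m≤m+n Δ _)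
                          (∸-monoˡ-≤ 1 Δ<wy) (λ v _ _ → Δ≤w v)
          ; unused⇒2Δ = reweight-ind w c z≢y (λ v c′ → (F ∪ ⁅ z ⁆) v ≡ false → 2 * Δ ≤ c′)
                          (λ z∉F′ → contradictionᵇ (y∈⁅y⁆ z) (proj₂ (∪-false⁻ F ⁅ z ⁆ z∉F′)))
                          (λ y∉F′ → contradictionᵇ y∈F (proj₁ (∪-false⁻ F ⁅ z ⁆ y∉F′)))
                          (λ v _ _ v∉F′ → unused⇒2Δ v (proj₁ (∪-false⁻ F ⁅ z ⁆ v∉F′)))
          }

        used′ : ∀ a → toℕ a ≤ suc j → (F ∪ ⁅ z ⁆) (ψ′ a) ≡ true
        used′ a a≤1+j with a ≟ suc j′
        ... | yes refl = subst (λ v → (F ∪ ⁅ z ⁆) v ≡ true) (sym ψ′-new) (⊆-∪ʳ F ⁅ z ⁆ z (y∈⁅y⁆ z))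
        ... | no  a≢new = subst (λ v → (F ∪ ⁅ z ⁆) v ≡ true) (sym (ψ′-old a≢new))
                            (⊆-∪ˡ F ⁅ z ⁆ _ (used a (below a≤1+j a≢new)))

        fresh′ : ∀ a → toℕ a ≤ suc j → a ≢ zero → F₀ (ψ′ a) ≡ false
        fresh′ a a≤1+j a≢0 with a ≟ suc j′
        ... | yes refl  = subst (λ v → F₀ v ≡ false) (sym ψ′-new) z∉F₀
        ... | no  a≢new = subst (λ v → F₀ v ≡ false) (sym (ψ′-old a≢new)) (fresh a (below a≤1+j a≢new) a≢0)

        injective′ : ∀ a b → toℕ a ≤ suc j → toℕ b ≤ suc j → ψ′ a ≡ ψ′ b → a ≡ b
        injective′ a b a≤1+j b≤1+j ψ′a≡ψ′b with a ≟ suc j′ | b ≟ suc j′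
        ... | yes refl  | yes refl  = refl
        ... | yes refl  | no  b≢new = contradiction (sym (trans (sym ψ′-new) (trans ψ′a≡ψ′b (ψ′-old b≢new))))
                                        (ψ≢z (below b≤1+j b≢new))
        ... | no  a≢new | yes refl  = contradiction (trans (sym (ψ′-old a≢new)) (trans ψ′a≡ψ′b ψ′-new))
                                        (ψ≢z (below a≤1+j a≢new))
        ... | no  a≢new | no  b≢new = injective a b (below a≤1+j a≢new) (below b≤1+j b≢new)
                                        (trans (sym (ψ′-old a≢new)) (trans ψ′a≡ψ′b (ψ′-old b≢new)))

        edge′ : ∀ i → suc (toℕ i) ≤ suc j → adj G (ψ′ (suc i)) (ψ′ (parent T i)) ≡ true
        edge′ i i<1+j with i ≟ j′
        ... | yes refl = subst₂ (λ u v → adj G u v ≡ true) (sym ψ′-new) (sym (ψ′-old (old≢new p≤j)))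
                           (trans (Graph.sym G z y) yz)
        ... | no  i≢j′ = subst₂ (λ u v → adj G u v ≡ true)
                           (sym (ψ′-old (old≢new i<j))) (sym (ψ′-old (old≢new (≤-trans (parent< T i) (<⇒≤ i<j)))))
                           (edge i i<j)
          where
          i<j : suc (toℕ i) ≤ j
          i<j = ≤∧≢⇒< (s≤s⁻¹ i<1+j) (i≢j′ ∘ Fin.toℕ-injective)

        reserve′ : ∀ a → toℕ a ≤ suc j → Δ + pending T (suc j) a ≤ w′ (ψ′ a)
        reserve′ a a≤1+j with a ≟ suc j′
        ... | yes refl = subst (Δ + pending T (suc j) (suc j′) ≤_)
                           (sym (trans (cong w′ ψ′-new) (reweight-z w c z≢y)))
                           (+-monoʳ-≤ Δ (pending≤children T (suc j) (suc j′)))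
        ... | no a≢new with a ≟ p
        ...   | yes refl = subst (Δ + pending T (suc j) p ≤_)
                             (sym (trans (cong w′ (ψ′-old a≢new)) (reweight-y w c z≢y)))
                             (∸-monoˡ-≤ 1 (≤-trans (≤-reflexive (sym (+-suc Δ _)))
                                            (≤-trans (+-monoʳ-≤ Δ (pending-parent T j′)) (reserve p p≤j))))
        ...   | no  a≢p  = subst (Δ + pending T (suc j) a ≤_)
                             (sym (trans (cong w′ (ψ′-old a≢new)) (reweight-other w c z≢y (ψ≢z a≤j) ψa≢y)))
                             (≤-trans (+-monoʳ-≤ Δ (pending-suc T j a)) (reserve a a≤j))
          where
          a≤j = below a≤1+j a≢new
          ψa≢y : ψ a ≢ y
          ψa≢y = a≢p ∘ injective a p a≤j p≤j

        keep′ : ∀ v → F₀ v ≡ true → v ≢ x → w′ v ≡ w₀ v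
        keep′ v v∈F₀ v≢x = trans (reweight-other w c z≢y v≢z v≢y) (keep v v∈F₀ v≢x)
          where
          v≢z : v ≢ z
          v≢z refl = contradictionᵇ v∈F₀ z∉F₀
          -- The only image lying in F₀ is the root, mapped to x.
          v≢y : v ≢ y
          v≢y refl with p ≟ zero
          ... | yes p≡0 = v≢x (trans (cong ψ p≡0) root)
          ... | no  p≢0 = contradictionᵇ v∈F₀ (fresh p p≤j p≢0)

      next : PartialCopy (suc j)
      next = record
        { ψ = ψ′ ; F = F ∪ ⁅ z ⁆ ; w = w′ ; inv = inv′
        ; ∣F∣ = trans (card-insert {S = F} z∉F) (trans (cong suc ∣F∣) (sym (+-suc (card F₀) j)))
        ; F₀⊆F = λ v v∈F₀ → ⊆-∪ˡ F ⁅ z ⁆ v (F₀⊆F v v∈F₀)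
        ; root = trans (ψ′-old λ ()) root
        ; used = used′ ; fresh = fresh′ ; injective = injective′ ; edge = edge′
        ; reserve = reserve′ ; keep = keep′
        }

    partialCopy : ∀ j → j ≤ k T → PartialCopy j
    partialCopy zero    _   = initial
    partialCopy (suc j) j<k = subst PartialCopy (cong suc (Fin.toℕ-fromℕ< j<k))
      (Step.next (fromℕ< j<k) (subst PartialCopy (sym (Fin.toℕ-fromℕ< j<k)) (partialCopy j (<⇒≤ j<k))))

    completeCopy : PartialCopy (k T)
    completeCopy = partialCopy (k T) ≤-refl

    completeCopy-isRootedCopy : IsRootedCopy G T x (PartialCopy.ψ completeCopy)
    completeCopy-isRootedCopy =
      (λ {a} {b} → injective a b (toℕ≤k T a) (toℕ≤k T b)) , root , λ j′ → edge j′ (Fin.toℕ<n j′)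
      where open PartialCopy completeCopy

  record DisjointCopies {t} (x : Fin t → Fin n) (T : Fin t → RootedTree) (F₀ : Subsetᶠ n) : Set where
    field
      φ        : (i : Fin t) → V (T i) → Fin n
      F        : Subsetᶠ n
      w        : Fin n → ℕ
      inv      : Invariant F w
      copy     : ∀ i → IsRootedCopy G (T i) (x i) (φ i)
      disjoint : ∀ i j → i ≢ j → ∀ a b → φ i a ≢ φ j b
      used     : ∀ i a → F (φ i a) ≡ true
      fresh    : ∀ i a → a ≢ zero → F₀ (φ i a) ≡ false
      F₀⊆F     : F₀ ⊆ F

    open Invariant inv

    image : Subsetᶠ n
    image v = anyFin λ i → anyFin λ a → ⌊ φ i a ≟ v ⌋

    image⊆F : image ⊆ F
    image⊆F v v∈image with anyFin⁻ _ v∈image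
    ... | i , v∈φi with anyFin⁻ _ v∈φi
    ...   | a , φia≟v = subst (λ u → F u ≡ true) (⌊⌋-true⁻ (φ i a ≟ v) φia≟v) (used i a)

    spare : ∀ S → ∣ S ∣ ≤ m → Δ * ∣ S ∣ ≤ ∣ Γ G S ─ UnionImage T φ ∣
    spare S ∣S∣≤m = begin
      Δ * ∣ S ∣                  ≡⟨ cong (Δ *_) (∣∣≡card S) ⟩
      Δ * card (lookup S)        ≤⟨ *card-≤-weight Δ Δ≤w (lookup S) ⟩
      weight w (lookup S)        ≤⟨ good (lookup S) (subst (_≤ m) (∣∣≡card S) ∣S∣≤m) ⟩
      freeNbrs F (lookup S)      ≤⟨ freeNbrs-antitone image⊆F (lookup S) ⟩
      freeNbrs image (lookup S)  ≡⟨ ∣Γ─tabulate∣ S image ⟨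
      ∣ Γ G S ─ UnionImage T φ ∣ ∎
      where open ≤-Reasoning

  embedForest : ∀ {t} (x : Fin t → Fin n) → Injective _≡_ _≡_ x →
                (T : Fin t → RootedTree) → (∀ i → MaxDegLe (T i) Δ) →
                ∀ {F₀ w₀} → Invariant F₀ w₀ → (∀ i → F₀ (x i) ≡ true) →
                (∀ i → Δ + droot (T i) ≤ w₀ (x i)) → card F₀ + sum (λ i → k (T i)) ≤ M →
                DisjointCopies x T F₀
  embedForest {zero} x _ T _ {F₀} {w₀} inv₀ _ _ _ = record
    { φ = λ () ; F = F₀ ; w = w₀ ; inv = inv₀ ; copy = λ () ; disjoint = λ ()
    ; used = λ () ; fresh = λ () ; F₀⊆F = λ _ → id }
  embedForest {suc t} x x-inj T ΔT≤Δ {F₀} inv₀ x∈F₀ Δ+droot≤wx budget = record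
    { φ = φ ; F = rest.F ; w = rest.w ; inv = rest.inv ; copy = copy ; disjoint = disjoint
    ; used = used ; fresh = fresh ; F₀⊆F = λ v → rest.F₀⊆F v ∘ first.F₀⊆F v }
    where
    budget₀ : card F₀ + k (T zero) ≤ M
    budget₀ = ≤-trans (+-monoʳ-≤ (card F₀) (m≤m+n _ _)) budget

    module first-tree = SingleTree (T zero) (ΔT≤Δ zero) (x zero) inv₀ (x∈F₀ zero) (Δ+droot≤wx zero) budget₀
    module first = first-tree.PartialCopy first-tree.completeCopy

    x-suc≢x-zero : ∀ i → x (suc i) ≢ x zero
    x-suc≢x-zero i = (λ ()) ∘ x-inj

    rest : DisjointCopies (x ∘ suc) (T ∘ suc) first.F
    rest = embedForest (x ∘ suc) (Fin.suc-injective ∘ x-inj) (T ∘ suc) (ΔT≤Δ ∘ suc) first.inv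
             (λ i → first.F₀⊆F _ (x∈F₀ (suc i)))
             (λ i → subst (Δ + droot (T (suc i)) ≤_) (sym (first.keep _ (x∈F₀ (suc i)) (x-suc≢x-zero i)))
                          (Δ+droot≤wx (suc i)))
             (subst (_≤ M) (sym (trans (cong (_+ _) first.∣F∣) (+-assoc (card F₀) _ _))) budget)
    module rest = DisjointCopies rest

    φ : (i : Fin (suc t)) → V (T i) → Fin n
    φ zero    = first.ψ
    φ (suc i) = rest.φ i

    copy : ∀ i → IsRootedCopy G (T i) (x i) (φ i)
    copy zero    = first-tree.completeCopy-isRootedCopy
    copy (suc i) = rest.copy i

    -- Non-root vertices of the first tree avoid F₀, which contains the other
    -- roots; non-root vertices of the other trees avoid everything the first
    -- tree uses.
    first≢rest : ∀ i a b → first.ψ a ≢ rest.φ i b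
    first≢rest i zero    zero    ψa≡φb =
      x-suc≢x-zero i (trans (sym (proj₁ (proj₂ (rest.copy i)))) (trans (sym ψa≡φb) first.root))
    first≢rest i (suc a) zero    ψa≡φb =
      contradictionᵇ (subst (λ v → F₀ v ≡ true) (sym (trans ψa≡φb (proj₁ (proj₂ (rest.copy i)))))
                            (x∈F₀ (suc i)))
                     (first.fresh (suc a) (toℕ≤k (T zero) (suc a)) λ ())
    first≢rest i a       (suc b) ψa≡φb =
      contradictionᵇ (subst (λ v → first.F v ≡ true) ψa≡φb (first.used a (toℕ≤k (T zero) a)))
                     (rest.fresh i (suc b) λ ())

    disjoint : ∀ i j → i ≢ j → ∀ a b → φ i a ≢ φ j b
    disjoint zero    zero    i≢j = contradiction refl i≢j
    disjoint zero    (suc j) _   a b = first≢rest j a b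
    disjoint (suc i) zero    _   a b = first≢rest i b a ∘ sym
    disjoint (suc i) (suc j) i≢j = rest.disjoint i j (i≢j ∘ cong suc)

    used : ∀ i a → rest.F (φ i a) ≡ true
    used zero    a = rest.F₀⊆F _ (first.used a (toℕ≤k (T zero) a))
    used (suc i) a = rest.used i a

    fresh : ∀ i a → a ≢ zero → F₀ (φ i a) ≡ false
    fresh zero    a a≢0 = first.fresh a (toℕ≤k (T zero) a) a≢0
    fresh (suc i) a a≢0 with F₀ (rest.φ i a) in φa∈F₀
    ... | true  = contradictionᵇ (first.F₀⊆F _ φa∈F₀) (rest.fresh i a a≢0)
    ... | false = refl

[]*-sum : ∀ {t} b (f : Fin t → ℕ) → [ b ]* sum f ≡ sum λ i → [ b ]* f i
[]*-sum true  f = refl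
[]*-sum false f = sym (sum-zero (λ i → [ false ]* f i) λ _ → refl)

module PointMasses {n t} (x : Fin t → Fin n) (x-inj : Injective _≡_ _≡_ x) where

  X : Subsetᶠ n
  X v = anyFin λ i → ⌊ x i ≟ v ⌋

  x∈X : ∀ i → X (x i) ≡ true
  x∈X i = anyFin⁺ _ i (⌊⌋-true (x i ≟ x i) refl)

  ∈X⁻ : ∀ {v} → X v ≡ true → ∃ λ i → x i ≡ v
  ∈X⁻ {v} v∈X = let (i , xi≟v) = anyFin⁻ _ v∈X in i , ⌊⌋-true⁻ (x i ≟ v) xi≟v

  mass : (Fin t → ℕ) → Fin n → ℕ
  mass c v = sum λ i → [ ⌊ x i ≟ v ⌋ ]* c i

  mass-x : ∀ c i → mass c (x i) ≡ c i
  mass-x c i = trans (sum-supported-at _ i λ j j≢i → cong ([_]* c j) (⌊⌋-false (x j ≟ x i) (j≢i ∘ x-inj)))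
                     (cong ([_]* c i) (⌊⌋-true (x i ≟ x i) refl))

  mass-∉X : ∀ c {v} → X v ≡ false → mass c v ≡ 0
  mass-∉X c {v} v∉X = sum-zero _ λ i → cong ([_]* c i) (⌊⌋-false (x i ≟ v) λ xi≡v →
                        contradictionᵇ (subst (λ u → X u ≡ true) xi≡v (x∈X i)) v∉X)

  weight-mass : ∀ c S → weight (mass c) S ≡ sum λ i → [ S (x i) ]* c i
  weight-mass c S = begin
    sum (λ v → [ S v ]* sum λ i → [ ⌊ x i ≟ v ⌋ ]* c i)
      ≡⟨ sum-cong-≗ (λ v → []*-sum (S v) λ i → [ ⌊ x i ≟ v ⌋ ]* c i) ⟩
    sum (λ v → sum λ i → [ S v ]* ([ ⌊ x i ≟ v ⌋ ]* c i))
      ≡⟨ ∑-comm (λ v i → [ S v ]* ([ ⌊ x i ≟ v ⌋ ]* c i)) ⟩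
    sum (λ i → sum λ v → [ S v ]* ([ ⌊ x i ≟ v ⌋ ]* c i))
      ≡⟨ sum-cong-≗ (λ i → sum-supported-at _ (x i) (off-x i)) ⟩
    sum (λ i → [ S (x i) ]* ([ ⌊ x i ≟ x i ⌋ ]* c i))
      ≡⟨ sum-cong-≗ (λ i → cong (λ b → [ S (x i) ]* ([ b ]* c i)) (⌊⌋-true (x i ≟ x i) refl)) ⟩
    sum (λ i → [ S (x i) ]* c i)
      ∎
    where
    open ≡-Reasoning
    off-x : ∀ i v → v ≢ x i → [ S v ]* ([ ⌊ x i ≟ v ⌋ ]* c i) ≡ 0
    off-x i v v≢xi rewrite ⌊⌋-false (x i ≟ v) (v≢xi ∘ sym) with S v
    ... | true  = refl
    ... | false = refl

  card-X : card X ≤ t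
  card-X = begin
    card X                            ≤⟨ sum-mono-≤ X≤mass ⟩
    weight (mass (λ _ → 1)) (λ _ → true)  ≡⟨ weight-mass (λ _ → 1) (λ _ → true) ⟩
    sum {t} (λ _ → 1)                 ≡⟨ sum-one t ⟩
    t                                 ∎
    where
    open ≤-Reasoning
    X≤mass : ∀ v → [ X v ]* 1 ≤ mass (λ _ → 1) v
    X≤mass v with X v in v∈X
    ... | false = z≤n
    ... | true  = let (i , xi≡v) = ∈X⁻ v∈X in
                  subst (λ u → 1 ≤ mass (λ _ → 1) u) xi≡v (≤-reflexive (sym (mass-x (λ _ → 1) i)))

weight-+ : ∀ {n} (f g : Fin n → ℕ) S → weight (λ v → f v + g v) S ≡ weight f S + weight g S
weight-+ f g S = trans (sum-cong-≗ λ v → []*-+ (S v)) (∑-distrib-+ (λ v → [ S v ]* f v) (λ v → [ S v ]* g v))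
  where
  []*-+ : ∀ b {c d} → [ b ]* (c + d) ≡ [ b ]* c + [ b ]* d
  []*-+ true  = refl
  []*-+ false = refl

weight-const-∖ : ∀ {n} K (S X : Subsetᶠ n) → weight (λ v → [ not (X v) ]* K) S ≡ K * card (S ∖ X)
weight-const-∖ K S X = trans (sum-cong-≗ pointwise) (sym (*-distribˡ-sum K λ v → [ (S ∖ X) v ]* 1))
  where
  pointwise : ∀ v → [ S v ]* ([ not (X v) ]* K) ≡ K * [ (S ∖ X) v ]* 1
  pointwise v with S v | X v
  ... | true  | false = sym (*-identityʳ K)
  ... | true  | true  = sym (*-zeroʳ K)
  ... | false | _     = sym (*-zeroʳ K)

module InitialWeight {n t} (G : Graph n) (Δ m : ℕ) (x : Fin t → Fin n) (x-inj : Injective _≡_ _≡_ x)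
  (T : Fin t → RootedTree) (ΔT≤Δ : ∀ i → MaxDegLe (T i) Δ) where

  open Neighbourhood G
  open Goodness G Δ m
  open PointMasses x x-inj

  rootReserve : Fin t → ℕ
  rootReserve i = droot (T i) + Δ

  rootSum : Subsetᶠ n → ℕ
  rootSum S = sum λ i → [ S (x i) ]* rootReserve i

  w₀ : Fin n → ℕ
  w₀ v = mass rootReserve v + [ not (X v) ]* (2 * Δ)

  w₀-x : ∀ i → w₀ (x i) ≡ droot (T i) + Δ
  w₀-x i rewrite x∈X i = trans (+-identityʳ _) (mass-x rootReserve i)

  w₀-∉X : ∀ {v} → X v ≡ false → w₀ v ≡ 2 * Δ
  w₀-∉X v∉X rewrite v∉X | mass-∉X rootReserve v∉X = refl

  weight-w₀ : ∀ S → weight w₀ S ≡ rootSum S + 2 * Δ * card (S ∖ X)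
  weight-w₀ S = trans (weight-+ (mass rootReserve) _ S)
                      (cong₂ _+_ (weight-mass rootReserve S) (weight-const-∖ (2 * Δ) S X))

  card-X+∑k≤∑size : card X + sum (λ i → k (T i)) ≤ sumFin (λ i → size (T i))
  card-X+∑k≤∑size = ≤-trans (+-monoˡ-≤ _ card-X) (≤-reflexive (sym (begin
    sumFin (λ i → size (T i))                ≡⟨ sumFin≡sum (λ i → size (T i)) ⟩
    sum (λ i → 1 + k (T i))                  ≡⟨ ∑-distrib-+ (λ _ → 1) (λ i → k (T i)) ⟩
    sum {t} (λ _ → 1) + sum (λ i → k (T i))  ≡⟨ cong (_+ sum (λ i → k (T i))) (sum-one t) ⟩
    t + sum (λ i → k (T i))                  ∎)))
    where open ≡-Reasoning

  w₀-ind : (P : ℕ → Set) → (∀ i → P (droot (T i) + Δ)) → P (2 * Δ) → ∀ v → P (w₀ v)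
  w₀-ind P P-root P-other v = by-membership (X v) refl
    where
    by-membership : ∀ b → X v ≡ b → P (w₀ v)
    by-membership true  v∈X = let (i , xi≡v) = ∈X⁻ v∈X in
                              subst (P ∘ w₀) xi≡v (subst P (sym (w₀-x i)) (P-root i))
    by-membership false v∉X = subst P (sym (w₀-∉X v∉X)) P-other

  initialInvariant :
    (∀ (S : Subset n) → ∣ S ∣ ≤ m → 4 * Δ * ∣ S ─ XSet x ∣ + rootWeight x T Δ S ≤ ∣ Γ G S ─ XSet x ∣) →
    Invariant X w₀
  initialInvariant hyp = record
    { good      = good₀
    ; w≤2Δ      = w₀-ind (_≤ 2 * Δ) droot+Δ≤2Δ ≤-refl
    ; Δ≤w       = w₀-ind (Δ ≤_) (λ i → m≤n+m Δ _) (m≤m+n Δ _)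
    ; unused⇒2Δ = λ v v∉X → ≤-reflexive (sym (w₀-∉X v∉X))
    }
    where
    droot+Δ≤2Δ : ∀ i → droot (T i) + Δ ≤ 2 * Δ
    droot+Δ≤2Δ i = +-mono-≤ (ΔT≤Δ i zero) (≤-reflexive (sym (+-identityʳ Δ)))

    rootWeight-tabulate : ∀ S → rootWeight x T Δ (tabulate S) ≡ rootSum S
    rootWeight-tabulate S = trans (sumFin≡sum λ i → [ lookup (tabulate S) (x i) ]* rootReserve i)
                                  (sum-cong-≗ λ i → cong ([_]* rootReserve i) (lookup∘tabulate S (x i)))

    good₀ : Good X w₀
    good₀ S ∣S∣≤m = begin
      weight w₀ S
        ≡⟨ trans (weight-w₀ S) (+-comm (rootSum S) _) ⟩
      2 * Δ * card (S ∖ X) + rootSum S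
        ≤⟨ +-monoˡ-≤ (rootSum S) (*-monoˡ-≤ (card (S ∖ X)) (*-monoˡ-≤ Δ (m≤m+n 2 2))) ⟩
      4 * Δ * card (S ∖ X) + rootSum S
        ≡⟨ cong₂ (λ a b → 4 * Δ * a + b) (∣tabulate─tabulate∣ S X) (rootWeight-tabulate S) ⟨
      4 * Δ * ∣ tabulate S ─ XSet x ∣ + rootWeight x T Δ (tabulate S)
        ≤⟨ hyp (tabulate S) (subst (_≤ m) (sym (∣tabulate∣≡card S)) ∣S∣≤m) ⟩
      ∣ Γ G (tabulate S) ─ XSet x ∣
        ≡⟨ ∣Γ─tabulate∣ (tabulate S) X ⟩
      freeNbrs X (lookup (tabulate S))
        ≡⟨ freeNbrs-cong X (lookup∘tabulate S) ⟩
      freeNbrs X S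
        ∎
      where open ≤-Reasoning

lemma5p2 : (Δ M t m n : ℕ) → 1 ≤ Δ → 1 ≤ M → 1 ≤ t → 1 ≤ m →
    (G : Graph n) → (x : Fin t → Fin n) → Injective _≡_ _≡_ x →
    (T : Fin t → RootedTree) →
    sumFin (λ i → size (T i)) ≤ M →
    (∀ i → MaxDegLe (T i) Δ) →
    (∀ (S : Subset n) → m ≤ ∣ S ∣ → ∣ S ∣ ≤ 2 * m → M + 10 * Δ * m ≤ ∣ Γ G S ∣) →
    (∀ (S : Subset n) → ∣ S ∣ ≤ m →
      4 * Δ * ∣ S ─ XSet x ∣ + rootWeight x T Δ S ≤ ∣ Γ G S ─ XSet x ∣) →
    Σ ((i : Fin t) → V (T i) → Fin n) λ φ →
      (∀ i → IsRootedCopy G (T i) (x i) (φ i)) ×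
      (∀ i j → i ≢ j → ∀ a b → φ i a ≢ φ j b) ×
      (∀ (S : Subset n) → ∣ S ∣ ≤ m → Δ * ∣ S ∣ ≤ ∣ Γ G S ─ UnionImage T φ ∣)
lemma5p2 Δ M t m n 1≤Δ _ _ 1≤m G x x-inj T ∑∣T∣≤M ΔT≤Δ expansion hyp =
  φ , copy , disjoint , spare
  where
  open Neighbourhood G
  open PointMasses x x-inj
  open InitialWeight G Δ m x x-inj T ΔT≤Δ
  open TreeEmbedding G Δ M m 1≤Δ 1≤m (N-expansion expansion)
  open DisjointCopies (embedForest x x-inj T ΔT≤Δ (initialInvariant hyp) x∈X
                         (λ i → ≤-reflexive (trans (+-comm Δ _) (sym (w₀-x i))))
                         (≤-trans card-X+∑k≤∑size ∑∣T∣≤M))
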